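{- Let $\Gamma$ be a graph, let $G \leq \mathrm{Aut}(\Gamma)$, and let $\alpha = (v_0, \ldots, v_n)$ be a $G$-consistent walk of length $n \geq 2$ with a shunt $g \in \mathrm{Sh}_G(\alpha)$. Suppose that the walk $\hat{\alpha} = (v_0, \ldots, v_{n-1})$ has Property (R) with respect to $G$. Let $\ell = |\mathrm{Succ}_G(\alpha)|$, $k = |\mathrm{Succ}_G(\hat{\alpha})|$ and $X = \langle G_{\hat{\alpha}}, G_{\hat{\alpha}^g} \rangle$, where $\hat{\alpha}^g = (v_1, \ldots, v_n)$. If any of the following conditions holds, then $\alpha$ has Property (R) with respect to $G$: (a) there is no integer $i$ with $\ell \leq i < k$ and $i \mid k$; (b) the group $X$ acts transitively on the set $\mathrm{Succ}_G(\hat{\alpha})$; (c) $X = G_{(v_1, \ldots, v_{n-1})}$.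
   Context: All graphs are finite and simple with at least three vertices. Automorphisms act on the right, $x \mapsto x^g$, and act on tuples of vertices coordinatewise; for a tuple $\beta$ of vertices, $G_\beta$ denotes the subgroup of $G$ fixing every entry of $\beta$. A walk of length $n \geq 1$ is a tuple $(v_0, \ldots, v_n)$ of vertices in which any two consecutive vertices are adjacent; for such a walk $\alpha$, $\hat{\alpha} = (v_0, \ldots, v_{n-1})$. For $G \leq \mathrm{Aut}(\Gamma)$, a walk $\alpha = (v_0, \ldots, v_n)$ is $G$-consistent if there exists $g \in G$ (a shunt of $\alpha$) with $v_i^g = v_{i+1}$ for all $i \in \{0, \ldots, n-1\}$; $\mathrm{Sh}_G(\alpha)$ is the set of such shunts. For a $G$-consistent walk $\alpha = (v_0, \ldots, v_n)$, a walk $(v_1, \ldots, v_n, v_{n+1})$ is a $G$-successor of $\alpha$ if there is $g \in \mathrm{Sh}_G(\alpha)$ with $v_n^g = v_{n+1}$; $\mathrm{Succ}_G(\alpha)$ is the set of $G$-successors of $\alpha$. A $G$-consistent walk $\alpha$ has Property (R) with respect to $G$ if for every vertex $v$ there exists a sequence of walks $\beta_0 = \alpha, \beta_1, \ldots, \beta_m$ with $\beta_{i+1} \in \mathrm{Succ}_G(\beta_i)$ for all $i$ and the last vertex of $\beta_m$ equal to $v$. -}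

module Defs where

open import Data.Nat using (ℕ; zero; suc)
open import Data.Fin using (Fin; inject₁) renaming (suc to fsuc)
open import Data.Fin.Permutation using (Permutation′; _⟨$⟩ʳ_; id; flip; _∘ₚ_; _≈_)
open import Data.Vec using (Vec; lookup; map; init; tail; last; _∷ʳ_)
open import Data.Product using (Σ; ∃; _×_; _,_)
open import Function.Bundles using (_⇔_)
open import Relation.Binary.PropositionalEquality using (_≡_)
open import Data.Empty using (⊥)

record Graph (N : ℕ) : Set₁ where
  field
    Adj     : Fin N → Fin N → Set
    Adj-sym : ∀ {x y} → Adj x y → Adj y x
    irrefl  : ∀ {x} → Adj x x → ⊥
open Graph public

Perm : ℕ → Set
Perm N = Permutation′ N

-- Right action  x ↦ x^π
_^_ : ∀ {N} → Fin N → Perm N → Fin N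
x ^ π = π ⟨$⟩ʳ x

_^ᵛ_ : ∀ {N k} → Vec (Fin N) k → Perm N → Vec (Fin N) k
β ^ᵛ π = map (_^ π) β

IsAut : ∀ {N} → Graph N → Perm N → Set
IsAut Γ π = ∀ x y → Adj Γ x y ⇔ Adj Γ (x ^ π) (y ^ π)

record AutSubgroup {N : ℕ} (Γ : Graph N) : Set₁ where
  field
    mem      : Perm N → Set
    mem-resp : ∀ {π ρ} → π ≈ ρ → mem π → mem ρ
    mem-id   : mem id
    mem-∘    : ∀ {π ρ} → mem π → mem ρ → mem (π ∘ₚ ρ)
    mem-inv  : ∀ {π} → mem π → mem (flip π)
    mem-aut  : ∀ {π} → mem π → IsAut Γ π
open AutSubgroup public

Stab : ∀ {N k} {Γ : Graph N} → AutSubgroup Γ → Vec (Fin N) k → Perm N → Set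
Stab G β h = mem G h × (∀ i → lookup β i ^ h ≡ lookup β i)

data Gen {N : ℕ} (P Q : Perm N → Set) : Perm N → Set where
  gen-l   : ∀ {π} → P π → Gen P Q π
  gen-r   : ∀ {π} → Q π → Gen P Q π
  gen-id  : Gen P Q id
  gen-∘   : ∀ {π ρ} → Gen P Q π → Gen P Q ρ → Gen P Q (π ∘ₚ ρ)
  gen-inv : ∀ {π} → Gen P Q π → Gen P Q (flip π)
  gen-ext : ∀ {π ρ} → π ≈ ρ → Gen P Q π → Gen P Q ρ

IsWalk : ∀ {N n} → Graph N → Vec (Fin N) (suc n) → Set
IsWalk {n = n} Γ α = ∀ (i : Fin n) → Adj Γ (lookup α (inject₁ i)) (lookup α (fsuc i))

IsShunt : ∀ {N n} {Γ : Graph N} → AutSubgroup Γ → Vec (Fin N) (suc n) → Perm N → Set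
IsShunt {n = n} G α g = mem G g × (∀ (i : Fin n) → lookup α (inject₁ i) ^ g ≡ lookup α (fsuc i))

Consistent : ∀ {N n} {Γ : Graph N} → AutSubgroup Γ → Vec (Fin N) (suc n) → Set
Consistent {Γ = Γ} G α = IsWalk Γ α × ∃ λ g → IsShunt G α g

IsSucc : ∀ {N n} {Γ : Graph N} → AutSubgroup Γ →
         Vec (Fin N) (suc n) → Vec (Fin N) (suc n) → Set
IsSucc {Γ = Γ} G α β =
  Consistent G α × IsWalk Γ β × ∃ λ g → IsShunt G α g × β ≡ (tail α ∷ʳ (last α ^ g))

data Reach {N n} {Γ : Graph N} (G : AutSubgroup Γ) (α : Vec (Fin N) (suc n))
     : Vec (Fin N) (suc n) → Set where
  here : Reach G α α
  step : ∀ {β γ} → Reach G α β → IsSucc G β γ → Reach G α γ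

PropertyR : ∀ {N n} {Γ : Graph N} → AutSubgroup Γ → Vec (Fin N) (suc n) → Set
PropertyR {N} G α =
  Consistent G α × (∀ (v : Fin N) → ∃ λ β → Reach G α β × last β ≡ v)

HasCard : ∀ {N k} → (Vec (Fin N) k → Set) → ℕ → Set
HasCard {N} {k} S c =
  Σ (Fin c → Vec (Fin N) k) λ f →
    (∀ i → S (f i)) × (∀ i j → f i ≡ f j → i ≡ j) × (∀ β → S β → ∃ λ i → f i ≡ β)

Transitive : ∀ {N k} → (Perm N → Set) → (Vec (Fin N) k → Set) → Set
Transitive X S = ∀ β γ → S β → S γ → ∃ λ x → X x × β ^ᵛ x ≡ γ

{-# OPTIONS --safe #-}
-- Put α̂ = (v₀,…,vₙ₋₁), A = G_α̂, A' = G_(α̂^g), H = G_(v₁,…,vₙ₋₁) and X = ⟨A, A'⟩ ≤ H.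
-- The shunts of α form the coset A g = g A', and they carry walks reachable from α to walks
-- reachable from α; since a submonoid of a finite symmetric group is a subgroup, so does every
-- element of X. The shunts of α̂ form the coset g H, so when H ≤ X they preserve reachability
-- from α too, and Property (R) passes from α̂ to α along g⁻¹.
-- So it suffices that H ≤ X, which is hypothesis (c). Since A' = H_(vₙ) ≤ X, an element h ∈ H
-- lies in X as soon as vₙ^h ∈ vₙ^X; this gives (b), because Succ(α̂) ≅ vₙ^H as H-sets. For (a),
-- the right cosets of X cut the H-orbit vₙ^H, of size k, into blocks of a common size t with
-- t ∣ k, and the block of vₙ contains the ℓ distinct points vₙ^(s g⁻¹) for the shunts s
-- enumerating Succ(α); hence t = k and X = H. Membership in X is not decidable, so this count
-- is carried out under a double negation, which is harmless because reachability from α is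
-- then reachability under the ℓ maps x ↦ x^s of a finite set, hence decidable.

module Submission where

open import Defs
open import Data.Nat using (ℕ; zero; suc; _+_; _*_; _∸_; _⊓_; _≤_; _<_; z≤n; s≤s; _≤?_; _<?_; NonZero)
open import Data.Nat.Properties
  using (n<1+n; +-suc; +-comm; m≤n⇒∃[o]m+o≡n; ≤-trans; ≤-antisym; ≤-<-trans; <-≤-trans; <⇒≤;
         ≮⇒≥; ≰⇒>; ≤-pred; m⊓n≤m; +-monoˡ-<; m+[n∸m]≡n)
open import Data.Nat.Divisibility using (_∣_; divides; _∣0; ∣m∣n⇒∣m+n; ∣-refl)
open import Data.Nat.ListAction using (product)
open import Data.Nat.ListAction.Properties using (∈⇒∣product; product≢0)
open import Data.Fin using (Fin; inject₁; toℕ) renaming (zero to fzero; suc to fsuc)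
open import Data.Fin.Properties using (pigeonhole; suc-injective; 0≢1+n; any?; toℕ<n) renaming (_≟_ to _≟ᶠ_)
open import Data.Fin.Permutation using (inverseˡ; inverseʳ; id; flip; _∘ₚ_; _≈_)
open import Data.Fin.Subset using (Subset; inside; outside; _∈_; _∉_; _⊆_; _⊂_; _─_; _-_; ∣_∣; ⊤)
open import Data.Fin.Subset.Properties
  using (drop-∷-⊆; x∈p∧x≢y⇒x∈p-y; x∈p⇒∣p-x∣<∣p∣; x∈p∧x∉q⇒x∈p─q; p─q⊆p; p∩q≢∅⇒p─q⊂p;
         x∈p∩q⁺; nonempty?; Empty-unique; ∣⊥∣≡0; ∣⊤∣≡n; ∈⊤; ∣p∣≤n; ∣p∣≡n⇒p≡⊤)
open import Data.Fin.Subset.Induction using (Acc; acc; ⊂-wellFounded)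
open import Data.Vec using (Vec; []; _∷_; map; init; tail; last; _∷ʳ_; lookup; initLast; tabulate; here; there)
open import Data.Vec.Properties
  using (lookup-map; lookup∘tabulate; lookup⇒[]=; []=⇒lookup; map-∘; map-cong; map-id; map-∷ʳ; ∷ʳ-injective; last-∷ʳ)
open import Data.Vec.Relation.Binary.Pointwise.Extensional using (ext; Pointwise-≡⇒≡)
open import Data.List using (List; []; _∷_; foldl; foldr; length; take; drop; _++_; allFin) renaming (map to mapL)
open import Data.List.Properties using (foldl-++; length-++; length-take; length-drop; take++drop≡id)
open import Data.List.Membership.Propositional.Properties using (∈-map⁺; ∈-allFin)
open import Data.List.Relation.Unary.All using (universal)
import Data.List.Relation.Unary.All.Properties as All
open import Data.Product using (∃; ∃₂; _×_; _,_; proj₁; proj₂)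
open import Data.Sum using (_⊎_; inj₁; inj₂; [_,_])
open import Function.Bundles using (_⇔_; Equivalence)
open import Function.Definitions using (Injective)
open import Level using (0ℓ)
open import Relation.Binary.Core using (Rel)
open import Relation.Binary.Structures using (IsEquivalence; IsDecEquivalence)
open import Relation.Binary.PropositionalEquality hiding ([_])
open import Relation.Nullary using (¬_; Dec; yes; no; does)
open import Relation.Nullary.Negation using (¬¬-map)
open import Relation.Nullary.Decidable using (dec-true; map′; _⊎-dec_; ¬¬-excluded-middle; decidable-stable)

module _ {A : Set} where

  lookup-init : ∀ {n} (xs : Vec A (suc n)) i → lookup (init xs) i ≡ lookup xs (inject₁ i)
  lookup-init {suc n} (x ∷ xs) fzero = refl
  lookup-init {suc n} (x ∷ xs) (fsuc i) = lookup-init xs i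

  init-∷ʳ-last : ∀ {n} (xs : Vec A (suc n)) → xs ≡ init xs ∷ʳ last xs
  init-∷ʳ-last xs = proj₂ (proj₂ (initLast xs))

  tail≡tail-init-∷ʳ-last : ∀ {n} (xs : Vec A (suc (suc n))) → tail xs ≡ tail (init xs) ∷ʳ last xs
  tail≡tail-init-∷ʳ-last (x ∷ xs) = init-∷ʳ-last xs

  tail-init : ∀ {n} (xs : Vec A (suc (suc n))) → tail (init xs) ≡ init (tail xs)
  tail-init (x ∷ xs) = refl

  shift⇒map-init≡tail : ∀ {n} (f : A → A) (xs : Vec A (suc n)) →
                  (∀ i → f (lookup xs (inject₁ i)) ≡ lookup xs (fsuc i)) → map f (init xs) ≡ tail xs
  shift⇒map-init≡tail f xs@(_ ∷ _) shift = Pointwise-≡⇒≡ (ext λ i → begin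
    lookup (map f (init xs)) i   ≡⟨ lookup-map i f (init xs) ⟩
    f (lookup (init xs) i)       ≡⟨ cong f (lookup-init xs i) ⟩
    f (lookup xs (inject₁ i))    ≡⟨ shift i ⟩
    lookup xs (fsuc i)           ∎)
    where open ≡-Reasoning

  map-init≡tail⇒shift : ∀ {n} (f : A → A) (xs : Vec A (suc n)) →
                   map f (init xs) ≡ tail xs → ∀ i → f (lookup xs (inject₁ i)) ≡ lookup xs (fsuc i)
  map-init≡tail⇒shift f xs@(_ ∷ _) e i = begin
    f (lookup xs (inject₁ i))    ≡⟨ cong f (lookup-init xs i) ⟨
    f (lookup (init xs) i)       ≡⟨ lookup-map i f (init xs) ⟨
    lookup (map f (init xs)) i   ≡⟨ cong (λ ys → lookup ys i) e ⟩
    lookup xs (fsuc i)           ∎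
    where open ≡-Reasoning

module _ {A B : Set} where

  tail-map : ∀ {n} (f : A → B) (xs : Vec A (suc n)) → tail (map f xs) ≡ map f (tail xs)
  tail-map f (x ∷ xs) = refl

  init-map : ∀ {n} (f : A → B) (xs : Vec A (suc n)) → init (map f xs) ≡ map f (init xs)
  init-map {zero} f (x ∷ []) = refl
  init-map {suc n} f (x ∷ xs) = cong (f x ∷_) (init-map f xs)

  last-map : ∀ {n} (f : A → B) (xs : Vec A (suc n)) → last (map f xs) ≡ f (last xs)
  last-map {zero} f (x ∷ []) = refl
  last-map {suc n} f (x ∷ xs) = last-map f xs

module _ {N : ℕ} where

  ^-^-flip : ∀ (π : Perm N) x → (x ^ π) ^ flip π ≡ x
  ^-^-flip π x = inverseˡ π

  ^-flip-^ : ∀ (π : Perm N) x → (x ^ flip π) ^ π ≡ x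
  ^-flip-^ π x = inverseʳ π

  ^-injective : ∀ (π : Perm N) {x y} → x ^ π ≡ y ^ π → x ≡ y
  ^-injective π {x} {y} e = trans (sym (^-^-flip π x)) (trans (cong (_^ flip π) e) (^-^-flip π y))

  ^ᵛ-∘ : ∀ {k} (β : Vec (Fin N) k) π ρ → β ^ᵛ (π ∘ₚ ρ) ≡ (β ^ᵛ π) ^ᵛ ρ
  ^ᵛ-∘ β π ρ = map-∘ (_^ ρ) (_^ π) β

  ^ᵛ-resp : ∀ {k} (β : Vec (Fin N) k) {π ρ} → π ≈ ρ → β ^ᵛ π ≡ β ^ᵛ ρ
  ^ᵛ-resp β π≈ρ = map-cong π≈ρ β

  ^ᵛ-^ᵛ-flip : ∀ {k} (β : Vec (Fin N) k) π → (β ^ᵛ π) ^ᵛ flip π ≡ β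
  ^ᵛ-^ᵛ-flip β π = trans (sym (^ᵛ-∘ β π (flip π))) (trans (^ᵛ-resp β {π ∘ₚ flip π} {id} (^-^-flip π)) (map-id β))

  ^ᵛ-flip-^ᵛ : ∀ {k} (β : Vec (Fin N) k) π → (β ^ᵛ flip π) ^ᵛ π ≡ β
  ^ᵛ-flip-^ᵛ β π = trans (sym (^ᵛ-∘ β (flip π) π)) (trans (^ᵛ-resp β {flip π ∘ₚ π} {id} (^-flip-^ π)) (map-id β))

  power : Perm N → ℕ → Perm N
  power π zero = id
  power π (suc k) = π ∘ₚ power π k

  power-+ : ∀ π a b (x : Fin N) → x ^ power π (a + b) ≡ (x ^ power π a) ^ power π b
  power-+ π zero b x = refl
  power-+ π (suc a) b x = power-+ π a b (x ^ π)

  power-injective : ∀ π a {x y : Fin N} → x ^ power π a ≡ y ^ power π a → x ≡ y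
  power-injective π zero e = e
  power-injective π (suc a) e = ^-injective π (power-injective π a e)

  power-* : ∀ π c r (x : Fin N) → x ^ power π c ≡ x → x ^ power π (r * c) ≡ x
  power-* π c zero x fix = refl
  power-* π c (suc r) x fix =
    trans (power-+ π c (r * c) x) (trans (cong (_^ power π (r * c)) fix) (power-* π c r x fix))

  period : ∀ π (x : Fin N) → ∃ λ q → x ^ power π (suc q) ≡ x
  period π x with pigeonhole (n<1+n N) (λ i → x ^ power π (toℕ i))
  ... | i , j , i<j , eq with m≤n⇒∃[o]m+o≡n i<j
  ... | o , i+o≡j = o , power-injective π (toℕ i) (sym (begin
    x ^ power π (toℕ i)                     ≡⟨ eq ⟩
    x ^ power π (toℕ j)                     ≡⟨ cong (λ n → x ^ power π n) j≡1+o+i ⟩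
    x ^ power π (suc o + toℕ i)             ≡⟨ power-+ π (suc o) (toℕ i) x ⟩
    (x ^ power π (suc o)) ^ power π (toℕ i) ∎))
    where
    open ≡-Reasoning
    j≡1+o+i : toℕ j ≡ suc o + toℕ i
    j≡1+o+i = trans (sym i+o≡j) (cong suc (+-comm (toℕ i) o))

  order : ∀ π → ∃ λ e → NonZero e × ∀ (x : Fin N) → x ^ power π e ≡ x
  order π = product periods , product≢0 (All.map⁺ (universal (λ _ → _) (allFin N))) , returns
    where
    periods : List ℕ
    periods = mapL (λ x → suc (proj₁ (period π x))) (allFin N)
    returns : ∀ x → x ^ power π (product periods) ≡ x
    returns x with ∈⇒∣product (∈-map⁺ (λ x → suc (proj₁ (period π x))) (∈-allFin x))
    ... | divides r e = subst (λ n → x ^ power π n ≡ x) (sym e) (power-* π _ r x (proj₂ (period π x)))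

  flip≈power : ∀ π → ∃ λ p → flip π ≈ power π p
  flip≈power π with order π
  ... | suc p , _ , returns = p , λ x → begin
    x ^ flip π                         ≡⟨ returns (x ^ flip π) ⟨
    ((x ^ flip π) ^ π) ^ power π p     ≡⟨ cong (_^ power π p) (^-flip-^ π x) ⟩
    x ^ power π p                      ∎
    where open ≡-Reasoning

record IsSubgroup {N : ℕ} (P : Perm N → Set) : Set where
  field
    ∈-resp : ∀ {π ρ} → π ≈ ρ → P π → P ρ
    ∈-id   : P id
    ∈-∘    : ∀ {π ρ} → P π → P ρ → P (π ∘ₚ ρ)
    ∈-flip : ∀ {π} → P π → P (flip π)

module _ {N : ℕ} {P : Perm N → Set}
  (resp : ∀ {π ρ} → π ≈ ρ → P π → P ρ) (p-id : P id) (p-∘ : ∀ {π ρ} → P π → P ρ → P (π ∘ₚ ρ)) where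

  power-closed : ∀ {π} k → P π → P (power π k)
  power-closed zero _ = p-id
  power-closed (suc k) p = p-∘ p (power-closed k p)

  submonoid⇒subgroup : IsSubgroup P
  submonoid⇒subgroup = record
    { ∈-resp = resp
    ; ∈-id   = p-id
    ; ∈-∘    = p-∘
    ; ∈-flip = λ {π} p → let k , flip≈πᵏ = flip≈power π in resp (λ x → sym (flip≈πᵏ x)) (power-closed k p)
    }

module _ {N : ℕ} {P Q : Perm N → Set} where

  Gen-isSubgroup : IsSubgroup (Gen P Q)
  Gen-isSubgroup = record { ∈-resp = gen-ext ; ∈-id = gen-id ; ∈-∘ = gen-∘ ; ∈-flip = gen-inv }

  module _ {S : Perm N → Set} (S-sub : IsSubgroup S) (P⊆S : ∀ {π} → P π → S π) (Q⊆S : ∀ {π} → Q π → S π) where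
    open IsSubgroup S-sub

    Gen-least : ∀ {π} → Gen P Q π → S π
    Gen-least (gen-l p) = P⊆S p
    Gen-least (gen-r q) = Q⊆S q
    Gen-least gen-id = ∈-id
    Gen-least (gen-∘ x y) = ∈-∘ (Gen-least x) (Gen-least y)
    Gen-least (gen-inv x) = ∈-flip (Gen-least x)
    Gen-least (gen-ext e x) = ∈-resp e (Gen-least x)

module _ {N : ℕ} {Γ : Graph N} (G : AutSubgroup Γ) where

  module _ {k : ℕ} (β : Vec (Fin N) k) {h : Perm N} where

    Stab⇒fixes : Stab G β h → β ^ᵛ h ≡ β
    Stab⇒fixes (_ , fix) = Pointwise-≡⇒≡ (ext λ i → trans (lookup-map i (_^ h) β) (fix i))

    fixes⇒Stab : mem G h → β ^ᵛ h ≡ β → Stab G β h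
    fixes⇒Stab h∈G fix = h∈G , λ i → trans (sym (lookup-map i (_^ h) β)) (cong (λ γ → lookup γ i) fix)

  Stab-isSubgroup : ∀ {k} (β : Vec (Fin N) k) → IsSubgroup (Stab G β)
  Stab-isSubgroup β = record
    { ∈-resp = λ {π} {ρ} π≈ρ s →
        fixes⇒Stab β (mem-resp G {π} {ρ} π≈ρ (proj₁ s)) (trans (sym (^ᵛ-resp β {π} {ρ} π≈ρ)) (Stab⇒fixes β s))
    ; ∈-id   = fixes⇒Stab β (mem-id G) (map-id β)
    ; ∈-∘    = λ {π} {ρ} s t → fixes⇒Stab β (mem-∘ G (proj₁ s) (proj₁ t))
        (trans (^ᵛ-∘ β π ρ) (trans (cong (_^ᵛ ρ) (Stab⇒fixes β s)) (Stab⇒fixes β t)))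
    ; ∈-flip = λ {π} s → fixes⇒Stab β (mem-inv G (proj₁ s))
        (trans (cong (_^ᵛ flip π) (sym (Stab⇒fixes β s))) (^ᵛ-^ᵛ-flip β π))
    }

  Stab-∷ʳ⁺ : ∀ {k} (β : Vec (Fin N) k) {x h} → Stab G β h → x ^ h ≡ x → Stab G (β ∷ʳ x) h
  Stab-∷ʳ⁺ β {x} {h} s fix =
    fixes⇒Stab (β ∷ʳ x) (proj₁ s) (trans (map-∷ʳ (_^ h) x β) (cong₂ _∷ʳ_ (Stab⇒fixes β s) fix))

  Stab-∷ʳ⁻ : ∀ {k} (β : Vec (Fin N) k) {x h} → Stab G (β ∷ʳ x) h → Stab G β h × x ^ h ≡ x
  Stab-∷ʳ⁻ β {x} {h} s with ∷ʳ-injective (β ^ᵛ h) β (trans (sym (map-∷ʳ (_^ h) x β)) (Stab⇒fixes (β ∷ʳ x) s))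
  ... | fixβ , fixx = fixes⇒Stab β (proj₁ s) fixβ , fixx

  Stab-tail : ∀ {k} (β : Vec (Fin N) (suc k)) {h} → Stab G β h → Stab G (tail β) h
  Stab-tail β {h} s = fixes⇒Stab (tail β) (proj₁ s) (trans (sym (tail-map (_^ h) β)) (cong tail (Stab⇒fixes β s)))

  module _ {n : ℕ} (β : Vec (Fin N) (suc n)) {t : Perm N} where

    IsShunt⇒shifts : IsShunt G β t → init β ^ᵛ t ≡ tail β
    IsShunt⇒shifts (_ , shift) = shift⇒map-init≡tail (_^ t) β shift

    shifts⇒IsShunt : mem G t → init β ^ᵛ t ≡ tail β → IsShunt G β t
    shifts⇒IsShunt t∈G shifts = t∈G , map-init≡tail⇒shift (_^ t) β shifts

    shunt-image : IsShunt G β t → β ^ᵛ t ≡ tail β ∷ʳ (last β ^ t)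
    shunt-image sh = begin
      β ^ᵛ t                              ≡⟨ cong (_^ᵛ t) (init-∷ʳ-last β) ⟩
      (init β ∷ʳ last β) ^ᵛ t             ≡⟨ map-∷ʳ (_^ t) (last β) (init β) ⟩
      (init β ^ᵛ t) ∷ʳ (last β ^ t)       ≡⟨ cong (_∷ʳ (last β ^ t)) (IsShunt⇒shifts sh) ⟩
      tail β ∷ʳ (last β ^ t)              ∎
      where open ≡-Reasoning

  module _ {n : ℕ} (β : Vec (Fin N) (suc n)) where

    shunt-∘-Stab : ∀ {u h} → IsShunt G β u → Stab G (tail β) h → IsShunt G β (u ∘ₚ h)
    shunt-∘-Stab {u} {h} sh s = shifts⇒IsShunt β (mem-∘ G (proj₁ sh) (proj₁ s)) (begin
      init β ^ᵛ (u ∘ₚ h)        ≡⟨ ^ᵛ-∘ (init β) u h ⟩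
      (init β ^ᵛ u) ^ᵛ h        ≡⟨ cong (_^ᵛ h) (IsShunt⇒shifts β sh) ⟩
      tail β ^ᵛ h               ≡⟨ Stab⇒fixes (tail β) s ⟩
      tail β                    ∎)
      where open ≡-Reasoning

    Stab-∘-shunt : ∀ {a u} → Stab G (init β) a → IsShunt G β u → IsShunt G β (a ∘ₚ u)
    Stab-∘-shunt {a} {u} s sh = shifts⇒IsShunt β (mem-∘ G (proj₁ s) (proj₁ sh)) (begin
      init β ^ᵛ (a ∘ₚ u)        ≡⟨ ^ᵛ-∘ (init β) a u ⟩
      (init β ^ᵛ a) ^ᵛ u        ≡⟨ cong (_^ᵛ u) (Stab⇒fixes (init β) s) ⟩
      init β ^ᵛ u               ≡⟨ IsShunt⇒shifts β sh ⟩
      tail β                    ∎)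
      where open ≡-Reasoning

    flip-shunt-∘-shunt : ∀ {u u'} → IsShunt G β u → IsShunt G β u' → Stab G (tail β) (flip u ∘ₚ u')
    flip-shunt-∘-shunt {u} {u'} sh sh' = fixes⇒Stab (tail β) (mem-∘ G (mem-inv G (proj₁ sh)) (proj₁ sh')) (begin
      tail β ^ᵛ (flip u ∘ₚ u')          ≡⟨ ^ᵛ-∘ (tail β) (flip u) u' ⟩
      (tail β ^ᵛ flip u) ^ᵛ u'          ≡⟨ cong (λ γ → (γ ^ᵛ flip u) ^ᵛ u') (IsShunt⇒shifts β sh) ⟨
      ((init β ^ᵛ u) ^ᵛ flip u) ^ᵛ u'   ≡⟨ cong (_^ᵛ u') (^ᵛ-^ᵛ-flip (init β) u) ⟩
      init β ^ᵛ u'                      ≡⟨ IsShunt⇒shifts β sh' ⟩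
      tail β                            ∎)
      where open ≡-Reasoning

    shunt-∘-flip-shunt : ∀ {u u'} → IsShunt G β u → IsShunt G β u' → Stab G (init β) (u ∘ₚ flip u')
    shunt-∘-flip-shunt {u} {u'} sh sh' = fixes⇒Stab (init β) (mem-∘ G (proj₁ sh) (mem-inv G (proj₁ sh'))) (begin
      init β ^ᵛ (u ∘ₚ flip u')          ≡⟨ ^ᵛ-∘ (init β) u (flip u') ⟩
      (init β ^ᵛ u) ^ᵛ flip u'          ≡⟨ cong (_^ᵛ flip u') (IsShunt⇒shifts β sh) ⟩
      tail β ^ᵛ flip u'                 ≡⟨ cong (_^ᵛ flip u') (IsShunt⇒shifts β sh') ⟨
      (init β ^ᵛ u') ^ᵛ flip u'         ≡⟨ ^ᵛ-^ᵛ-flip (init β) u' ⟩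
      init β                            ∎)
      where open ≡-Reasoning

    shunt-conj : ∀ {t w} → IsShunt G β t → mem G w → IsShunt G (β ^ᵛ w) (flip w ∘ₚ t ∘ₚ w)
    shunt-conj {t} {w} sh w∈G = shifts⇒IsShunt (β ^ᵛ w) (mem-∘ G (mem-inv G w∈G) (mem-∘ G (proj₁ sh) w∈G)) (begin
      init (β ^ᵛ w) ^ᵛ (flip w ∘ₚ t ∘ₚ w)       ≡⟨ cong (_^ᵛ (flip w ∘ₚ t ∘ₚ w)) (init-map (_^ w) β) ⟩
      (init β ^ᵛ w) ^ᵛ (flip w ∘ₚ t ∘ₚ w)       ≡⟨ ^ᵛ-∘ (init β ^ᵛ w) (flip w) (t ∘ₚ w) ⟩
      ((init β ^ᵛ w) ^ᵛ flip w) ^ᵛ (t ∘ₚ w)     ≡⟨ ^ᵛ-∘ _ t w ⟩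
      (((init β ^ᵛ w) ^ᵛ flip w) ^ᵛ t) ^ᵛ w     ≡⟨ cong (λ γ → (γ ^ᵛ t) ^ᵛ w) (^ᵛ-^ᵛ-flip (init β) w) ⟩
      (init β ^ᵛ t) ^ᵛ w                        ≡⟨ cong (_^ᵛ w) (IsShunt⇒shifts β sh) ⟩
      tail β ^ᵛ w                               ≡⟨ tail-map (_^ w) β ⟨
      tail (β ^ᵛ w)                             ∎)
      where open ≡-Reasoning

  IsShunt-init : ∀ {n} (β : Vec (Fin N) (suc (suc n))) {t} → IsShunt G β t → IsShunt G (init β) t
  IsShunt-init β {t} sh = shifts⇒IsShunt (init β) (proj₁ sh) (begin
    init (init β) ^ᵛ t     ≡⟨ init-map (_^ t) (init β) ⟨
    init (init β ^ᵛ t)     ≡⟨ cong init (IsShunt⇒shifts β sh) ⟩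
    init (tail β)          ≡⟨ tail-init β ⟨
    tail (init β)          ∎)
    where open ≡-Reasoning

module _ {N : ℕ} {Γ : Graph N} (G : AutSubgroup Γ) where

  walk-^ᵛ : ∀ {n} (β : Vec (Fin N) (suc n)) {w} → IsWalk Γ β → mem G w → IsWalk Γ (β ^ᵛ w)
  walk-^ᵛ β {w} walk w∈G i =
    subst₂ (Adj Γ) (sym (lookup-map _ (_^ w) β)) (sym (lookup-map _ (_^ w) β))
      (Equivalence.to (mem-aut G w∈G _ _) (walk i))

  walk-init : ∀ {n} (β : Vec (Fin N) (suc (suc n))) → IsWalk Γ β → IsWalk Γ (init β)
  walk-init β walk i =
    subst₂ (Adj Γ) (sym (lookup-init β (inject₁ i))) (sym (lookup-init β (fsuc i))) (walk (inject₁ i))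

  Consistent-^ᵛ : ∀ {n} (β : Vec (Fin N) (suc n)) {w} → Consistent G β → mem G w → Consistent G (β ^ᵛ w)
  Consistent-^ᵛ β (walk , t , sh) w∈G = walk-^ᵛ β walk w∈G , _ , shunt-conj G β sh w∈G

  Consistent-init : ∀ {n} (β : Vec (Fin N) (suc (suc n))) → Consistent G β → Consistent G (init β)
  Consistent-init β (walk , t , sh) = walk-init β walk , t , IsShunt-init G β sh

  shunt-succ : ∀ {n} (β : Vec (Fin N) (suc n)) {t} → Consistent G β → IsShunt G β t → IsSucc G β (β ^ᵛ t)
  shunt-succ β c sh = c , walk-^ᵛ β (proj₁ c) (proj₁ sh) , _ , sh , shunt-image G β sh

  module _ {n : ℕ} (β γ : Vec (Fin N) (suc n)) where

    succ-shunt : IsSucc G β γ → ∃ λ t → IsShunt G β t × γ ≡ β ^ᵛ t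
    succ-shunt (_ , _ , t , sh , γ≡) = t , sh , trans γ≡ (sym (shunt-image G β sh))

    succ-shape : IsSucc G β γ → γ ≡ tail β ∷ʳ last γ
    succ-shape (_ , _ , t , _ , γ≡) =
      trans γ≡ (cong (tail β ∷ʳ_) (sym (trans (cong last γ≡) (last-∷ʳ _ (tail β)))))

    succ-^ᵛ : ∀ {w} → IsSucc G β γ → mem G w → IsSucc G (β ^ᵛ w) (γ ^ᵛ w)
    succ-^ᵛ {w} s w∈G with succ-shunt s
    ... | t , sh , γ≡βᵗ = subst (IsSucc G (β ^ᵛ w)) γʷ≡
          (shunt-succ (β ^ᵛ w) (Consistent-^ᵛ β (proj₁ s) w∈G) (shunt-conj G β sh w∈G))
      where
      open ≡-Reasoning
      γʷ≡ : (β ^ᵛ w) ^ᵛ (flip w ∘ₚ t ∘ₚ w) ≡ γ ^ᵛ w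
      γʷ≡ = begin
        (β ^ᵛ w) ^ᵛ (flip w ∘ₚ t ∘ₚ w)        ≡⟨ trans (^ᵛ-∘ (β ^ᵛ w) (flip w) (t ∘ₚ w)) (^ᵛ-∘ _ t w) ⟩
        (((β ^ᵛ w) ^ᵛ flip w) ^ᵛ t) ^ᵛ w      ≡⟨ cong (λ δ → (δ ^ᵛ t) ^ᵛ w) (^ᵛ-^ᵛ-flip β w) ⟩
        (β ^ᵛ t) ^ᵛ w                         ≡⟨ cong (_^ᵛ w) γ≡βᵗ ⟨
        γ ^ᵛ w                                ∎

  reach-^ᵛ : ∀ {n} {β γ : Vec (Fin N) (suc n)} {w} → Reach G β γ → mem G w → Reach G (β ^ᵛ w) (γ ^ᵛ w)
  reach-^ᵛ here w∈G = here
  reach-^ᵛ (step {γ} {δ} r s) w∈G = step (reach-^ᵛ r w∈G) (succ-^ᵛ γ δ s w∈G)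

  reach-trans : ∀ {n} {β γ δ : Vec (Fin N) (suc n)} → Reach G β γ → Reach G γ δ → Reach G β δ
  reach-trans r here = r
  reach-trans r (step r' s) = step (reach-trans r r') s

  module _ {n : ℕ} (α : Vec (Fin N) (suc n)) where

    succ-of-image : ∀ {w γ} → mem G w → IsSucc G (α ^ᵛ w) γ → ∃ λ u → IsShunt G α u × γ ≡ α ^ᵛ (u ∘ₚ w)
    succ-of-image {w} {γ} w∈G s with succ-shunt α (γ ^ᵛ flip w) (subst (λ δ → IsSucc G δ (γ ^ᵛ flip w))
                                       (^ᵛ-^ᵛ-flip α w) (succ-^ᵛ (α ^ᵛ w) γ s (mem-inv G w∈G)))
    ... | u , sh , γʷ⁻¹≡αᵘ = u , sh , (begin
      γ                        ≡⟨ ^ᵛ-flip-^ᵛ γ w ⟨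
      (γ ^ᵛ flip w) ^ᵛ w       ≡⟨ cong (_^ᵛ w) γʷ⁻¹≡αᵘ ⟩
      (α ^ᵛ u) ^ᵛ w            ≡⟨ ^ᵛ-∘ α u w ⟨
      α ^ᵛ (u ∘ₚ w)            ∎)
      where open ≡-Reasoning

    module _ {P : Perm N → Set} (P⊆G : ∀ {w} → P w → mem G w) (P-id : P id)
      (P-step : ∀ {u w} → IsShunt G α u → P w → ∃ λ w' → P w' × α ^ᵛ (u ∘ₚ w) ≡ α ^ᵛ w') where

      reach⇒orbit : ∀ {β} → Reach G α β → ∃ λ w → P w × β ≡ α ^ᵛ w
      reach⇒orbit here = id , P-id , sym (map-id α)
      reach⇒orbit (step r s) with reach⇒orbit r
      ... | w , pw , refl with succ-of-image (P⊆G pw) s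
      ... | u , sh , refl = P-step sh pw

-- Decidability over finite sets

¬¬-Π-Fin : ∀ {n} {P : Fin n → Set} → (∀ i → ¬ ¬ P i) → ¬ ¬ (∀ i → P i)
¬¬-Π-Fin {zero} _ k = k (λ ())
¬¬-Π-Fin {suc n} ¬¬P k =
  ¬¬P fzero λ p₀ → ¬¬-Π-Fin (λ i → ¬¬P (fsuc i)) λ ps → k λ { fzero → p₀ ; (fsuc i) → ps i }

module _ {n ℓ : ℕ} (σ : Fin ℓ → Fin n → Fin n) where

  run : Fin n → List (Fin ℓ) → Fin n
  run = foldl (λ x i → σ i x)

  reachable-within? : ∀ d x y → Dec (∃ λ is → length is ≤ d × run x is ≡ y)
  reachable-within? zero x y = map′ (λ e → [] , z≤n , e) (λ { ([] , _ , e) → e }) (x ≟ᶠ y)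
  reachable-within? (suc d) x y = map′
    (λ { (inj₁ e) → [] , z≤n , e ; (inj₂ (i , is , len≤d , e)) → i ∷ is , s≤s len≤d , e })
    (λ { ([] , _ , e) → inj₁ e ; (i ∷ is , s≤s len≤d , e) → inj₂ (i , is , len≤d , e) })
    ((x ≟ᶠ y) ⊎-dec any? (λ i → reachable-within? d (σ i x) y))

  -- A list of more than n steps visits some point twice; cutting out the loop shortens it.
  shortcut : ∀ x is → ∃ λ js → length js ≤ n × run x js ≡ run x is
  shortcut x [] = [] , z≤n , refl
  shortcut x (i ∷ is) with shortcut (σ i x) is
  ... | js , len≤n , e with suc (length js) ≤? n
  ... | yes len'≤n = i ∷ js , len'≤n , e
  ... | no len'≰n with pigeonhole (n<1+n n) (λ a → run x (take (toℕ a) (i ∷ js)))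
  ... | a , b , a<b , same = take (toℕ a) ks ++ drop (toℕ b) ks , ≤-pred (<-≤-trans shorter (s≤s len≤n)) , (begin
    run x (take (toℕ a) ks ++ drop (toℕ b) ks)         ≡⟨ foldl-++ _ x (take (toℕ a) ks) (drop (toℕ b) ks) ⟩
    run (run x (take (toℕ a) ks)) (drop (toℕ b) ks)    ≡⟨ cong (λ y → run y (drop (toℕ b) ks)) same ⟩
    run (run x (take (toℕ b) ks)) (drop (toℕ b) ks)    ≡⟨ foldl-++ _ x (take (toℕ b) ks) (drop (toℕ b) ks) ⟨
    run x (take (toℕ b) ks ++ drop (toℕ b) ks)         ≡⟨ cong (run x) (take++drop≡id (toℕ b) ks) ⟩
    run x ks                                           ≡⟨ e ⟩
    run x (i ∷ is)                                     ∎)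
    where
    open ≡-Reasoning
    ks = i ∷ js
    L = length ks
    b≤L : toℕ b ≤ L
    b≤L = ≤-trans (≤-pred (toℕ<n b)) (<⇒≤ (≰⇒> len'≰n))
    shorter : length (take (toℕ a) ks ++ drop (toℕ b) ks) < L
    shorter = subst₂ _<_
      (sym (trans (length-++ (take (toℕ a) ks)) (cong₂ _+_ (length-take (toℕ a) ks) (length-drop (toℕ b) ks))))
      (m+[n∸m]≡n b≤L)
      (+-monoˡ-< (L ∸ toℕ b) (≤-<-trans (m⊓n≤m (toℕ a) L) a<b))

  reachable? : ∀ x y → Dec (∃ λ is → run x is ≡ y)
  reachable? x y = map′ (λ (is , _ , e) → is , e)
    (λ (is , e) → let js , len≤n , e' = shortcut x is in js , len≤n , trans e' e)
    (reachable-within? n x y)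

-- Counting in finite sets

∣p∣≡∣p─q∣+∣q∣ : ∀ {n} (p q : Subset n) → q ⊆ p → ∣ p ∣ ≡ ∣ p ─ q ∣ + ∣ q ∣
∣p∣≡∣p─q∣+∣q∣ [] [] _ = refl
∣p∣≡∣p─q∣+∣q∣ (inside ∷ p) (inside ∷ q) q⊆p =
  trans (cong suc (∣p∣≡∣p─q∣+∣q∣ p q (drop-∷-⊆ q⊆p))) (sym (+-suc _ _))
∣p∣≡∣p─q∣+∣q∣ (inside ∷ p) (outside ∷ q) q⊆p = cong suc (∣p∣≡∣p─q∣+∣q∣ p q (drop-∷-⊆ q⊆p))
∣p∣≡∣p─q∣+∣q∣ (outside ∷ p) (outside ∷ q) q⊆p = ∣p∣≡∣p─q∣+∣q∣ p q (drop-∷-⊆ q⊆p)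
∣p∣≡∣p─q∣+∣q∣ (outside ∷ p) (inside ∷ q) q⊆p with q⊆p here
... | ()

x∈p─q⇒x∉q : ∀ {n} (p q : Subset n) {x} → x ∈ p ─ q → x ∉ q
x∈p─q⇒x∉q (_ ∷ p) (_ ∷ q) (there x∈p─q) (there x∈q) = x∈p─q⇒x∉q p q x∈p─q x∈q

injection⇒∣p∣≤∣q∣ : ∀ {m n} (f : Fin m → Fin n) → Injective _≡_ _≡_ f →
                    (p : Subset m) (q : Subset n) → (∀ {x} → x ∈ p → f x ∈ q) → ∣ p ∣ ≤ ∣ q ∣
injection⇒∣p∣≤∣q∣ f f-inj [] q _ = z≤n
injection⇒∣p∣≤∣q∣ f f-inj (outside ∷ p) q f[p]⊆q =
  injection⇒∣p∣≤∣q∣ (λ x → f (fsuc x)) (λ e → suc-injective (f-inj e)) p q (λ x∈p → f[p]⊆q (there x∈p))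
injection⇒∣p∣≤∣q∣ f f-inj (inside ∷ p) q f[p]⊆q =
  ≤-<-trans (injection⇒∣p∣≤∣q∣ (λ x → f (fsuc x)) (λ e → suc-injective (f-inj e)) p (q - f fzero)
              (λ x∈p → x∈p∧x≢y⇒x∈p-y (f[p]⊆q (there x∈p)) (λ e → 0≢1+n (sym (f-inj e)))))
            (x∈p⇒∣p-x∣<∣p∣ (f[p]⊆q here))

module _ {n : ℕ} {_~_ : Rel (Fin n) 0ℓ} (~-isDecEquivalence : IsDecEquivalence _~_) where

  open IsDecEquivalence ~-isDecEquivalence renaming (refl to ~-refl; sym to ~-sym; trans to ~-trans)

  class : Fin n → Subset n
  class x = tabulate (λ y → does (x ≟ y))

  ∈class⁺ : ∀ {x y} → x ~ y → y ∈ class x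
  ∈class⁺ {x} {y} x~y = lookup⇒[]= y (class x) (trans (lookup∘tabulate _ y) (dec-true (x ≟ y) x~y))

  ∈class⁻ : ∀ {x y} → y ∈ class x → x ~ y
  ∈class⁻ {x} {y} y∈class with x ≟ y | trans (sym (lookup∘tabulate _ y)) ([]=⇒lookup y∈class)
  ... | yes x~y | _ = x~y
  ... | no _    | ()

  Closed : Subset n → Set
  Closed S = ∀ {x} → x ∈ S → class x ⊆ S

  module _ {t : ℕ} (∣class∣≡t : ∀ x → ∣ class x ∣ ≡ t) where

    closed⇒∣ : ∀ S → Acc _⊂_ S → Closed S → t ∣ ∣ S ∣
    closed⇒∣ S (acc rec) closed with nonempty? S
    ... | no empty = subst (t ∣_) (sym (trans (cong ∣_∣ (Empty-unique empty)) (∣⊥∣≡0 n))) (t ∣0)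
    ... | yes (x , x∈S) = subst (t ∣_) (sym (∣p∣≡∣p─q∣+∣q∣ S (class x) (closed x∈S)))
          (∣m∣n⇒∣m+n (closed⇒∣ (S ─ class x) (rec smaller) closed') (subst (t ∣_) (sym (∣class∣≡t x)) ∣-refl))
      where
      smaller : S ─ class x ⊂ S
      smaller = p∩q≢∅⇒p─q⊂p S (class x) (x , x∈p∩q⁺ (x∈S , ∈class⁺ ~-refl))
      closed' : Closed (S ─ class x)
      closed' {y} y∈S' {z} y~z = x∈p∧x∉q⇒x∈p─q (closed (p─q⊆p S (class x) y∈S') y~z)
        (λ x~z → x∈p─q⇒x∉q S (class x) y∈S' (∈class⁺ (~-trans (∈class⁻ x~z) (~-sym (∈class⁻ y~z)))))

    equal-classes⇒∣ : t ∣ n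
    equal-classes⇒∣ = subst (t ∣_) (∣⊤∣≡n n) (closed⇒∣ ⊤ (⊂-wellFounded ⊤) (λ _ _ → ∈⊤))

-- Blocks of imprimitivity

module PointStabiliser {N : ℕ} {H X : Perm N → Set} (H-isSubgroup : IsSubgroup H) (X-isSubgroup : IsSubgroup X)
  (X⊆H : ∀ {x} → X x → H x) (v : Fin N) (H-stab⊆X : ∀ {h} → H h → v ^ h ≡ v → X h) where

  open IsSubgroup

  X-coset : ∀ {h x} → H h → X x → v ^ x ≡ v ^ h → X h
  X-coset {h} {x} h∈H x∈X vˣ≡vʰ =
    ∈-resp X-isSubgroup (λ y → ^-flip-^ x (y ^ h)) (∈-∘ X-isSubgroup (H-stab⊆X hx⁻¹∈H fix) x∈X)
    where
    hx⁻¹∈H : H (h ∘ₚ flip x)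
    hx⁻¹∈H = ∈-∘ H-isSubgroup h∈H (∈-flip H-isSubgroup (X⊆H x∈X))
    fix : (v ^ h) ^ flip x ≡ v
    fix = trans (cong (_^ flip x) (sym vˣ≡vʰ)) (^-^-flip x v)

  module Blocks {k : ℕ} (o : Fin k → Fin N) (o-injective : Injective _≡_ _≡_ o)
    (orbit : ∀ j → ∃ λ h → H h × v ^ h ≡ o j) (index : ∀ {h} → H h → ∃ λ j → o j ≡ v ^ h) where

    rep : Fin k → Perm N
    rep j = proj₁ (orbit j)

    rep∈H : ∀ j → H (rep j)
    rep∈H j = proj₁ (proj₂ (orbit j))

    v^rep : ∀ j → v ^ rep j ≡ o j
    v^rep j = proj₂ (proj₂ (orbit j))

    -- j ~ j' says that X rep j' = X rep j, i.e. o j' lies in the block (v ^ X) ^ rep j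
    _~_ : Rel (Fin k) 0ℓ
    j ~ j' = X (rep j' ∘ₚ flip (rep j))

    ~-isEquivalence : IsEquivalence _~_
    ~-isEquivalence = record
      { refl  = λ {j} → ∈-resp X-isSubgroup (λ y → sym (^-^-flip (rep j) y)) (∈-id X-isSubgroup)
      ; sym   = λ j~j' → ∈-resp X-isSubgroup (λ _ → refl) (∈-flip X-isSubgroup j~j')
      ; trans = λ {j} {j'} j~j' j'~j'' → ∈-resp X-isSubgroup (λ y → cong (_^ flip (rep j)) (^-flip-^ (rep j') _))
                  (∈-∘ X-isSubgroup j'~j'' j~j')
      }

    ~⁺ : ∀ {j j' x} → X x → v ^ (x ∘ₚ rep j) ≡ o j' → j ~ j'
    ~⁺ {j} {j'} {x} x∈X e = X-coset (∈-∘ H-isSubgroup (rep∈H j') (∈-flip H-isSubgroup (rep∈H j))) x∈X (begin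
      v ^ x                                        ≡⟨ ^-^-flip (rep j) (v ^ x) ⟨
      (v ^ (x ∘ₚ rep j)) ^ flip (rep j)            ≡⟨ cong (_^ flip (rep j)) (trans e (sym (v^rep j'))) ⟩
      v ^ (rep j' ∘ₚ flip (rep j))                 ∎)
      where open ≡-Reasoning

    module _ {m : ℕ} (x : Fin m → Perm N) (x∈H : ∀ i → H (x i)) (j : Fin k) where

      relocate : Fin m → Fin k
      relocate i = proj₁ (index (∈-∘ H-isSubgroup (x∈H i) (rep∈H j)))

      o-relocate : ∀ i → o (relocate i) ≡ v ^ (x i ∘ₚ rep j)
      o-relocate i = proj₂ (index (∈-∘ H-isSubgroup (x∈H i) (rep∈H j)))

      relocate-injective : Injective _≡_ _≡_ (λ i → v ^ x i) → Injective _≡_ _≡_ relocate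
      relocate-injective vˣ-injective {i} {i'} e =
        vˣ-injective (^-injective (rep j) (trans (sym (o-relocate i)) (trans (cong o e) (o-relocate i'))))

      relocate-~ : ∀ {i} → X (x i) → j ~ relocate i
      relocate-~ {i} x∈X = ~⁺ x∈X (sym (o-relocate i))

    j₀ : Fin k
    j₀ = proj₁ (index (∈-id H-isSubgroup))

    rep-j₀∈X : X (rep j₀)
    rep-j₀∈X = H-stab⊆X (rep∈H j₀) (trans (v^rep j₀) (proj₂ (index (∈-id H-isSubgroup))))

    module _ (_~?_ : ∀ j j' → Dec (j ~ j')) where

      ~-isDecEquivalence : IsDecEquivalence _~_
      ~-isDecEquivalence = record { isEquivalence = ~-isEquivalence ; _≟_ = _~?_ }

      block : Fin k → Subset k
      block = class ~-isDecEquivalence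

      ∣block∣-mono : ∀ j j' → ∣ block j ∣ ≤ ∣ block j' ∣
      ∣block∣-mono j j' =
        injection⇒∣p∣≤∣q∣ (relocate x x∈H j') (relocate-injective x x∈H j' x-injective) (block j) (block j')
          (λ i∈block → ∈class⁺ ~-isDecEquivalence (relocate-~ x x∈H j' (∈class⁻ ~-isDecEquivalence i∈block)))
        where
        x : Fin k → Perm N
        x i = rep i ∘ₚ flip (rep j)
        x∈H : ∀ i → H (x i)
        x∈H i = ∈-∘ H-isSubgroup (rep∈H i) (∈-flip H-isSubgroup (rep∈H j))
        x-injective : Injective _≡_ _≡_ (λ i → v ^ x i)
        x-injective e = o-injective (trans (sym (v^rep _)) (trans (^-injective (flip (rep j)) e) (v^rep _)))

      ∣block∣≡∣block-j₀∣ : ∀ j → ∣ block j ∣ ≡ ∣ block j₀ ∣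
      ∣block∣≡∣block-j₀∣ j = ≤-antisym (∣block∣-mono j j₀) (∣block∣-mono j₀ j)

      ≤∣block-j₀∣ : ∀ {ℓ} (a : Fin ℓ → Perm N) → (∀ i → X (a i)) → Injective _≡_ _≡_ (λ i → v ^ a i) →
                   ℓ ≤ ∣ block j₀ ∣
      ≤∣block-j₀∣ {ℓ} a a∈X a-injective = subst (_≤ ∣ block j₀ ∣) (∣⊤∣≡n ℓ)
        (injection⇒∣p∣≤∣q∣ (relocate a a∈H j₀) (relocate-injective a a∈H j₀ a-injective) ⊤ (block j₀)
          (λ _ → ∈class⁺ ~-isDecEquivalence (relocate-~ a a∈H j₀ (a∈X _))))
        where
        a∈H : ∀ i → H (a i)
        a∈H i = X⊆H (a∈X i)

      full-block⇒H⊆X : block j₀ ≡ ⊤ → ∀ {h} → H h → X h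
      full-block⇒H⊆X full {h} h∈H = X-coset h∈H (∈-∘ X-isSubgroup j₀~j rep-j₀∈X) (begin
        v ^ ((rep j ∘ₚ flip (rep j₀)) ∘ₚ rep j₀)    ≡⟨ ^-flip-^ (rep j₀) (v ^ rep j) ⟩
        v ^ rep j                                   ≡⟨ v^rep j ⟩
        o j                                         ≡⟨ proj₂ (index h∈H) ⟩
        v ^ h                                       ∎)
        where
        open ≡-Reasoning
        j = proj₁ (index h∈H)
        j₀~j : j₀ ~ j
        j₀~j = ∈class⁻ ~-isDecEquivalence (subst (j ∈_) (sym full) ∈⊤)

      H⊆X-or-divisor : ∀ {ℓ} (a : Fin ℓ → Perm N) → (∀ i → X (a i)) → Injective _≡_ _≡_ (λ i → v ^ a i) →
                       (∀ {h} → H h → X h) ⊎ ∃ λ t → ℓ ≤ t × t < k × t ∣ k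
      H⊆X-or-divisor a a∈X a-injective with ∣ block j₀ ∣ <? k
      ... | yes t<k =
        inj₂ (∣ block j₀ ∣ , ≤∣block-j₀∣ a a∈X a-injective , t<k , equal-classes⇒∣ ~-isDecEquivalence ∣block∣≡∣block-j₀∣)
      ... | no t≮k = inj₁ (full-block⇒H⊆X (∣p∣≡n⇒p≡⊤ (≤-antisym (∣p∣≤n (block j₀)) (≮⇒≥ t≮k))))

-- A consistent walk with a shunt

module WalkWithShunt {N : ℕ} {Γ : Graph N} (G : AutSubgroup Γ) {m : ℕ} (α : Vec (Fin N) (suc (suc (suc m))))
  {g : Perm N} (consα : Consistent G α) (shα : IsShunt G α g) where

  α̂ : Vec (Fin N) (suc (suc m))
  α̂ = init α

  vₙ : Fin N
  vₙ = last α

  A A' H X : Perm N → Set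
  A = Stab G α̂
  A' = Stab G (α̂ ^ᵛ g)
  H = Stab G (tail α̂)
  X = Gen A A'

  open IsSubgroup

  H-isSubgroup : IsSubgroup H
  H-isSubgroup = Stab-isSubgroup G (tail α̂)

  X-isSubgroup : IsSubgroup X
  X-isSubgroup = Gen-isSubgroup

  α̂ᵍ≡tail-α : α̂ ^ᵛ g ≡ tail α
  α̂ᵍ≡tail-α = IsShunt⇒shifts G α shα

  α̂ᵍ≡tail-α̂∷ʳvₙ : α̂ ^ᵛ g ≡ tail α̂ ∷ʳ vₙ
  α̂ᵍ≡tail-α̂∷ʳvₙ = trans α̂ᵍ≡tail-α (tail≡tail-init-∷ʳ-last α)

  last-α̂ᵍ : last α̂ ^ g ≡ vₙ
  last-α̂ᵍ = trans (sym (last-map (_^ g) α̂)) (trans (cong last α̂ᵍ≡tail-α̂∷ʳvₙ) (last-∷ʳ vₙ (tail α̂)))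

  vₙ^flip-g : vₙ ^ flip g ≡ last α̂
  vₙ^flip-g = trans (cong (_^ flip g) (sym last-α̂ᵍ)) (^-^-flip g (last α̂))

  consα̂ : Consistent G α̂
  consα̂ = Consistent-init G α consα

  shα̂ : IsShunt G α̂ g
  shα̂ = IsShunt-init G α shα

  A'⁺ : ∀ {c} → H c → vₙ ^ c ≡ vₙ → A' c
  A'⁺ c∈H fix = subst (λ β → Stab G β _) (sym α̂ᵍ≡tail-α̂∷ʳvₙ) (Stab-∷ʳ⁺ G (tail α̂) c∈H fix)

  A'⊆H : ∀ {c} → A' c → H c
  A'⊆H c∈A' = proj₁ (Stab-∷ʳ⁻ G (tail α̂) (subst (λ β → Stab G β _) α̂ᵍ≡tail-α̂∷ʳvₙ c∈A'))

  X⊆H : ∀ {x} → X x → H x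
  X⊆H = Gen-least H-isSubgroup (Stab-tail G α̂) A'⊆H

  H-stab⊆X : ∀ {h} → H h → vₙ ^ h ≡ vₙ → X h
  H-stab⊆X h∈H fix = gen-r (A'⁺ h∈H fix)

  open PointStabiliser H-isSubgroup X-isSubgroup X⊆H vₙ H-stab⊆X

  H-orbit→succ : ∀ {h} → H h → IsSucc G α̂ (tail α̂ ∷ʳ (vₙ ^ h))
  H-orbit→succ {h} h∈H = subst (IsSucc G α̂) shape (shunt-succ G α̂ consα̂ (shunt-∘-Stab G α̂ shα̂ h∈H))
    where
    shape : α̂ ^ᵛ (g ∘ₚ h) ≡ tail α̂ ∷ʳ (vₙ ^ h)
    shape = trans (shunt-image G α̂ (shunt-∘-Stab G α̂ shα̂ h∈H)) (cong (λ y → tail α̂ ∷ʳ (y ^ h)) last-α̂ᵍ)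

  succ→H-orbit : ∀ {γ} → IsSucc G α̂ γ → ∃ λ h → H h × vₙ ^ h ≡ last γ
  succ→H-orbit {γ} s with succ-shunt G α̂ γ s
  ... | u , sh , γ≡α̂ᵘ = flip g ∘ₚ u , flip-shunt-∘-shunt G α̂ shα̂ sh , (begin
    (vₙ ^ flip g) ^ u       ≡⟨ cong (_^ u) vₙ^flip-g ⟩
    last α̂ ^ u              ≡⟨ last-map (_^ u) α̂ ⟨
    last (α̂ ^ᵛ u)           ≡⟨ cong last γ≡α̂ᵘ ⟨
    last γ                  ∎)
    where open ≡-Reasoning

  M : Perm N → Set
  M w = mem G w × (∀ {β} → Reach G α β → Reach G α (β ^ᵛ w))

  M-isSubgroup : IsSubgroup M
  M-isSubgroup = submonoid⇒subgroup M-resp M-id M-∘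
    where
    M-resp : ∀ {π ρ} → π ≈ ρ → M π → M ρ
    M-resp {π} {ρ} π≈ρ (π∈G , πR) =
      mem-resp G {π} {ρ} π≈ρ π∈G , λ {β} r → subst (Reach G α) (^ᵛ-resp β {π} {ρ} π≈ρ) (πR r)
    M-id : M id
    M-id = mem-id G , λ {β} r → subst (Reach G α) (sym (map-id β)) r
    M-∘ : ∀ {π ρ} → M π → M ρ → M (π ∘ₚ ρ)
    M-∘ {π} {ρ} (π∈G , πR) (ρ∈G , ρR) =
      mem-∘ G π∈G ρ∈G , λ {β} r → subst (Reach G α) (sym (^ᵛ-∘ β π ρ)) (ρR (πR r))

  shunt∈M : ∀ {t} → IsShunt G α t → M t
  shunt∈M sh = proj₁ sh , λ r → reach-trans G (step here (shunt-succ G α consα sh)) (reach-^ᵛ G r (proj₁ sh))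

  X⊆M : ∀ {x} → X x → M x
  X⊆M = Gen-least M-isSubgroup A⊆M A'⊆M
    where
    g∈M : M g
    g∈M = shunt∈M shα
    A⊆M : ∀ {a} → A a → M a
    A⊆M {a} a∈A = ∈-resp M-isSubgroup (λ y → ^-^-flip g (y ^ a))
      (∈-∘ M-isSubgroup (shunt∈M (Stab-∘-shunt G α a∈A shα)) (∈-flip M-isSubgroup g∈M))
    A'⊆M : ∀ {c} → A' c → M c
    A'⊆M {c} c∈A' = ∈-resp M-isSubgroup (λ y → cong (_^ c) (^-flip-^ g y))
      (∈-∘ M-isSubgroup (∈-flip M-isSubgroup g∈M)
        (shunt∈M (shunt-∘-Stab G α shα (subst (λ β → Stab G β c) α̂ᵍ≡tail-α c∈A'))))

  module _ (H⊆X : ∀ {h} → H h → X h) where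

    α̂-shunt∈M : ∀ {u} → IsShunt G α̂ u → M u
    α̂-shunt∈M {u} sh = ∈-resp M-isSubgroup {g ∘ₚ flip g ∘ₚ u} (λ y → cong (_^ u) (^-^-flip g y))
      (∈-∘ M-isSubgroup (shunt∈M shα) (X⊆M (H⊆X (flip-shunt-∘-shunt G α̂ shα̂ sh))))

    reach-α̂⇒M-orbit : ∀ {β} → Reach G α̂ β → ∃ λ w → M w × β ≡ α̂ ^ᵛ w
    reach-α̂⇒M-orbit = reach⇒orbit G α̂ proj₁ (∈-id M-isSubgroup)
      (λ {u} {w} sh w∈M → u ∘ₚ w , ∈-∘ M-isSubgroup (α̂-shunt∈M sh) w∈M , refl)

    H⊆X⇒PropertyR : PropertyR G α̂ → PropertyR G α
    H⊆X⇒PropertyR (_ , reachα̂) = consα , reach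
      where
      reach : ∀ x → ∃ λ β → Reach G α β × last β ≡ x
      reach x with reachα̂ x
      ... | β , r , lastβ≡x with reach-α̂⇒M-orbit r
      ... | w , w∈M , refl = α ^ᵛ (flip g ∘ₚ w) , proj₂ g⁻¹w∈M here , (begin
        last (α ^ᵛ (flip g ∘ₚ w))     ≡⟨ last-map (_^ (flip g ∘ₚ w)) α ⟩
        (vₙ ^ flip g) ^ w             ≡⟨ cong (_^ w) vₙ^flip-g ⟩
        last α̂ ^ w                    ≡⟨ last-map (_^ w) α̂ ⟨
        last (α̂ ^ᵛ w)                 ≡⟨ lastβ≡x ⟩
        x                             ∎)
        where
        open ≡-Reasoning
        g⁻¹w∈M : M (flip g ∘ₚ w)
        g⁻¹w∈M = ∈-∘ M-isSubgroup (∈-flip M-isSubgroup (shunt∈M shα)) w∈M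

  transitive⇒H⊆X : Transitive X (IsSucc G α̂) → ∀ {h} → H h → X h
  transitive⇒H⊆X transitive {h} h∈H with transitive _ _ (H-orbit→succ (∈-id H-isSubgroup)) (H-orbit→succ h∈H)
  ... | x , x∈X , eq = X-coset h∈H x∈X (begin
    vₙ ^ x                              ≡⟨ cong (_^ x) (last-∷ʳ vₙ (tail α̂)) ⟨
    last (tail α̂ ∷ʳ vₙ) ^ x             ≡⟨ last-map (_^ x) (tail α̂ ∷ʳ vₙ) ⟨
    last ((tail α̂ ∷ʳ vₙ) ^ᵛ x)          ≡⟨ cong last eq ⟩
    last (tail α̂ ∷ʳ (vₙ ^ h))           ≡⟨ last-∷ʳ (vₙ ^ h) (tail α̂) ⟩
    vₙ ^ h                              ∎)
    where open ≡-Reasoning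

  module _ {ℓ k : ℕ} (succα : HasCard (IsSucc G α) ℓ) (succα̂ : HasCard (IsSucc G α̂) k) where

    private
      f = proj₁ succα
      f-succ = proj₁ (proj₂ succα)
      f-injective = proj₁ (proj₂ (proj₂ succα))
      f-onto = proj₂ (proj₂ (proj₂ succα))
      f̂ = proj₁ succα̂
      f̂-succ = proj₁ (proj₂ succα̂)
      f̂-injective = proj₁ (proj₂ (proj₂ succα̂))
      f̂-onto = proj₂ (proj₂ (proj₂ succα̂))

    s : Fin ℓ → Perm N
    s i = proj₁ (succ-shunt G α (f i) (f-succ i))

    s-shunt : ∀ i → IsShunt G α (s i)
    s-shunt i = proj₁ (proj₂ (succ-shunt G α (f i) (f-succ i)))

    f≡αˢ : ∀ i → f i ≡ α ^ᵛ s i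
    f≡αˢ i = proj₂ (proj₂ (succ-shunt G α (f i) (f-succ i)))

    a : Fin ℓ → Perm N
    a i = s i ∘ₚ flip g

    a∈X : ∀ i → X (a i)
    a∈X i = gen-l (shunt-∘-flip-shunt G α (s-shunt i) shα)

    vₙ^a-injective : Injective _≡_ _≡_ (λ i → vₙ ^ a i)
    vₙ^a-injective {i} {i'} e = f-injective i i' (begin
      f i                          ≡⟨ f≡αˢ i ⟩
      α ^ᵛ s i                     ≡⟨ shunt-image G α (s-shunt i) ⟩
      tail α ∷ʳ (vₙ ^ s i)         ≡⟨ cong (tail α ∷ʳ_) (^-injective (flip g) e) ⟩
      tail α ∷ʳ (vₙ ^ s i')        ≡⟨ shunt-image G α (s-shunt i') ⟨
      α ^ᵛ s i'                    ≡⟨ f≡αˢ i' ⟨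
      f i'                         ∎)
      where open ≡-Reasoning

    o : Fin k → Fin N
    o j = last (f̂ j)

    o-injective : Injective _≡_ _≡_ o
    o-injective {j} {j'} e = f̂-injective j j'
      (trans (succ-shape G α̂ _ (f̂-succ j)) (trans (cong (tail α̂ ∷ʳ_) e) (sym (succ-shape G α̂ _ (f̂-succ j')))))

    index : ∀ {h} → H h → ∃ λ j → o j ≡ vₙ ^ h
    index {h} h∈H with f̂-onto _ (H-orbit→succ h∈H)
    ... | j , f̂j≡ = j , trans (cong last f̂j≡) (last-∷ʳ (vₙ ^ h) (tail α̂))

    open Blocks o o-injective (λ j → succ→H-orbit (f̂-succ j)) index

    no-divisor⇒¬¬H⊆X : ¬ (∃ λ t → ℓ ≤ t × t < k × t ∣ k) → ¬ ¬ (∀ {h} → H h → X h)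
    no-divisor⇒¬¬H⊆X no-divisor ¬H⊆X =
      ¬¬-Π-Fin (λ j → ¬¬-Π-Fin (λ j' → ¬¬-excluded-middle)) λ _~?_ →
        [ ¬H⊆X , no-divisor ] (H⊆X-or-divisor _~?_ a a∈X vₙ^a-injective)

    word : List (Fin ℓ) → Perm N
    word = foldr (λ i w → s i ∘ₚ w) id

    ^-word : ∀ x is → x ^ word is ≡ run (λ i y → y ^ s i) x is
    ^-word x [] = refl
    ^-word x (i ∷ is) = ^-word (x ^ s i) is

    word∈M : ∀ is → M (word is)
    word∈M [] = ∈-id M-isSubgroup
    word∈M (i ∷ is) = ∈-∘ M-isSubgroup (shunt∈M (s-shunt i)) (word∈M is)

    shunt-∘-word : ∀ {u} → IsShunt G α u → ∀ is → ∃ λ i → α ^ᵛ (u ∘ₚ word is) ≡ α ^ᵛ word (i ∷ is)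
    shunt-∘-word {u} sh is with f-onto _ (shunt-succ G α consα sh)
    ... | i , fi≡αᵘ = i , (begin
      α ^ᵛ (u ∘ₚ word is)         ≡⟨ ^ᵛ-∘ α u (word is) ⟩
      (α ^ᵛ u) ^ᵛ word is         ≡⟨ cong (_^ᵛ word is) (trans (sym fi≡αᵘ) (f≡αˢ i)) ⟩
      (α ^ᵛ s i) ^ᵛ word is       ≡⟨ ^ᵛ-∘ α (s i) (word is) ⟨
      α ^ᵛ word (i ∷ is)          ∎)
      where open ≡-Reasoning

    IsWord : Perm N → Set
    IsWord w = ∃ λ is → w ≡ word is

    reach⇒word : ∀ {β} → Reach G α β → ∃ λ is → β ≡ α ^ᵛ word is
    reach⇒word r with reach⇒orbit G α {P = IsWord} (λ { (is , refl) → proj₁ (word∈M is) }) ([] , refl) word-step r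
      where
      word-step : ∀ {u w} → IsShunt G α u → IsWord w → ∃ λ w' → IsWord w' × α ^ᵛ (u ∘ₚ w) ≡ α ^ᵛ w'
      word-step sh (is , refl) with shunt-∘-word sh is
      ... | i , e = word (i ∷ is) , (i ∷ is , refl) , e
    ... | _ , (is , refl) , β≡ = is , β≡

    reachable-last? : ∀ x → Dec (∃ λ β → Reach G α β × last β ≡ x)
    reachable-last? x = map′ from-run to-run (reachable? (λ i y → y ^ s i) vₙ x)
      where
      from-run : (∃ λ is → run (λ i y → y ^ s i) vₙ is ≡ x) → ∃ λ β → Reach G α β × last β ≡ x
      from-run (is , e) = α ^ᵛ word is , proj₂ (word∈M is) here , trans (last-map _ α) (trans (^-word vₙ is) e)
      to-run : (∃ λ β → Reach G α β × last β ≡ x) → ∃ λ is → run (λ i y → y ^ s i) vₙ is ≡ x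
      to-run (β , r , e) with reach⇒word r
      ... | is , refl = is , trans (sym (^-word vₙ is)) (trans (sym (last-map _ α)) e)

    no-divisor⇒PropertyR : ¬ (∃ λ t → ℓ ≤ t × t < k × t ∣ k) → PropertyR G α̂ → PropertyR G α
    no-divisor⇒PropertyR no-divisor prα̂ = consα , λ x → decidable-stable (reachable-last? x)
      (¬¬-map {A = ∀ {h} → H h → X h} (λ H⊆X → proj₂ (H⊆X⇒PropertyR H⊆X prα̂) x)
        (no-divisor⇒¬¬H⊆X no-divisor))

-- The convention 3 ≤ N on graphs plays no role in the argument.
lemma3p6 : ∀ {N : ℕ} → 3 ≤ N → (Γ : Graph N) (G : AutSubgroup Γ)
    (m : ℕ) (α : Vec (Fin N) (suc (suc (suc m)))) (g : Perm N) →
    Consistent G α → IsShunt G α g → PropertyR G (init α) →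
    (∃₂ (λ ℓ k → HasCard (IsSucc G α) ℓ × HasCard (IsSucc G (init α)) k ×
        ¬ (∃ λ i → ℓ ≤ i × i < k × i ∣ k))
     ⊎ Transitive (Gen (Stab G (init α)) (Stab G (init α ^ᵛ g))) (IsSucc G (init α))
     ⊎ (∀ h → Gen (Stab G (init α)) (Stab G (init α ^ᵛ g)) h ⇔ Stab G (tail (init α)) h)) →
    PropertyR G α
lemma3p6 _ Γ G m α g consα shα prα̂ (inj₁ (ℓ , k , succα , succα̂ , no-divisor)) =
  no-divisor⇒PropertyR succα succα̂ no-divisor prα̂
  where open WalkWithShunt G α consα shα
lemma3p6 _ Γ G m α g consα shα prα̂ (inj₂ (inj₁ transitive)) =
  H⊆X⇒PropertyR (transitive⇒H⊆X transitive) prα̂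
  where open WalkWithShunt G α consα shα
lemma3p6 _ Γ G m α g consα shα prα̂ (inj₂ (inj₂ X⇔H)) =
  H⊆X⇒PropertyR (λ {h} → Equivalence.from (X⇔H h)) prα̂
  where open WalkWithShunt G α consα shα
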